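{- Let $G$ be an $r$-graph on $[n]$ with average degree $d>0$, let $\tau,\zeta>0$, let $I\subset[n]$, and let $T$ be the output of the container algorithm (described in the context) in prune mode with input $I$, using the weak threshold functions. Writing $\Gamma_1$ also for the set of vertices $v$ with $\{v\}$ in the final $\Gamma_1$, we have $\mu(T\setminus\Gamma_1)\le(r-1)(\tau/\zeta)(1+r\delta)$.
   Context: An $r$-graph ($r\ge2$) is an $r$-uniform hypergraph; $d(\sigma)$ is the number of edges containing $\sigma$, $d(u)=d(\{u\})$, $d$ the average degree, $\mu(U)=\frac1{nd}\sum_{u\in U}d(u)$. Let $\delta$ be the minimum real with $d(\sigma)\le\delta d\tau^{|\sigma|-1}$ for all $\sigma\subset[n]$, $|\sigma|\ge2$. Weak thresholds: for $1\le s\le r-1$, $\theta_s(\{u\})=\tau^{r-s}d(u)$ and $\theta_s(\sigma)=\delta d\tau^{r-s+|\sigma|-1}$ for $2\le|\sigma|\le s$. Container algorithm: $B=\{v:d(v)<\zeta d\}$; $P_r=E(G)$, initially $P_1,\dots,P_{r-1}$ empty multisets and $\Gamma_1,\dots,\Gamma_{r-1}$ empty; $d_s(\sigma)$ = number of members of $P_s$ (with multiplicity) containing $\sigma$. Prune mode: input $I$, initially $T=\emptyset$, output $T$; build mode: input $T$, initially $C=[n]$, output $C$. For $v=1,\dots,n$: for $s=1,\dots,r-1$ let $F_{v,s}$ be the multiset of $s$-sets $f\subset\{v+1,\dots,n\}$ with $\{v\}\cup f\in P_{s+1}$ (multiplicity inherited) containing no member of $\Gamma_s$. If $v\notin B$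 and either $|F_{v,s}|\ge\zeta\tau^{r-s-1}d(v)$ for some $s$ or $\{v\}\in\Gamma_1$: prune mode adds $v$ to $T$ if $v\in I$; build mode removes $v$ from $C$ if $v\notin T$; and if $v\in T$, for $s=1,\dots,r-1$ in turn add $F_{v,s}$ to $P_s$ and put into $\Gamma_s$ every $\sigma\subset\{v+1,\dots,n\}$, $1\le|\sigma|\le s$, with $d_s(\sigma)\ge\theta_s(\sigma)$.
   Formalization: The parameters τ and ζ are rational, and δ is taken as the least rational number satisfying its bound rather than the minimum real. -}

module Defs where

open import Data.Bool using (T?; Bool; true; false; _∧_; _∨_; not; if_then_else_)
open import Data.Nat as ℕ using (ℕ; zero; suc; _∸_)
open import Data.Fin using (Fin; toℕ)
open import Data.Fin.Subset using (Subset; ⁅_⁆; _∈_; _⊆_; ∣_∣; _─_; ⊥)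
open import Data.Fin.Subset.Properties using (_∈?_; _⊆?_)
open import Data.List using (List; []; _∷_; _++_; map; filter; length; foldl; allFin; applyUpTo)
open import Data.Bool.ListAction using (all; any)
open import Data.Nat.ListAction using (sum)
open import Data.List.Relation.Unary.All using (All)
open import Data.List.Relation.Unary.Unique.Propositional using (Unique)
open import Data.Vec using (Vec; tabulate) renaming ([] to []ᵥ; _∷_ to _∷ᵥ_)
open import Data.Integer using (+_)
open import Data.Rational using (ℚ; 0ℚ; 1ℚ; _*_; _+_; _≤_; _≤ᵇ_)
open import Relation.Nullary using (does)
open import Relation.Binary.PropositionalEquality using (_≡_)

-- Vertex set [n] is Fin n, ordered by toℕ (vertex "v" = toℕ v + 1).
-- Subsets of [n] are Data.Fin.Subset.Subset n.

record RGraph (r n : ℕ) : Set where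
  field
    edges   : List (Subset n)
    uniform : All (λ e → ∣ e ∣ ≡ r) edges
    simple  : Unique edges
open RGraph public

ℕ→ℚ : ℕ → ℚ
ℕ→ℚ k = + k Data.Rational./ 1

-- a / b as a rational (convention: 0 when b = 0; never used in that case
-- under the hypotheses of the lemma)
frac : ℕ → ℕ → ℚ
frac a zero    = 0ℚ
frac a (suc b) = (+ a) Data.Rational./ (suc b)

_^ℚ_ : ℚ → ℕ → ℚ
x ^ℚ zero  = 1ℚ
x ^ℚ suc k = x * (x ^ℚ k)

allSubsets : (n : ℕ) → List (Subset n)
allSubsets zero    = []ᵥ ∷ []
allSubsets (suc n) = map (false ∷ᵥ_) (allSubsets n) ++ map (true ∷ᵥ_) (allSubsets n)

degIn : ∀ {n} → List (Subset n) → Subset n → ℕ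
degIn P σ = length (filter (λ e → σ ⊆? e) P)

module _ {r n : ℕ} (G : RGraph r n) where

  deg : Subset n → ℕ
  deg σ = degIn (edges G) σ

  degV : Fin n → ℕ
  degV u = deg ⁅ u ⁆

  totalDeg : ℕ
  totalDeg = sum (map degV (allFin n))

  avgDeg : ℚ
  avgDeg = frac totalDeg n

  μ : Subset n → ℚ
  μ U = frac (sum (map degV (filter (λ u → u ∈? U) (allFin n)))) totalDeg

  DeltaBound : ℚ → ℚ → Set
  DeltaBound τ δ = ∀ (σ : Subset n) → 2 ℕ.≤ ∣ σ ∣ →
    ℕ→ℚ (deg σ) ≤ δ * avgDeg * (τ ^ℚ (∣ σ ∣ ∸ 1))

  -- δ is the minimum real (here: rational) with that property
  record IsDelta (τ δ : ℚ) : Set where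
    field
      bound   : DeltaBound τ δ
      minimal : ∀ δ′ → DeltaBound τ δ′ → δ ≤ δ′

  record AlgState : Set where
    field
      T : Subset n
      P : ℕ → List (Subset n)             -- multisets P_s (P_r = E(G))
      Γ : ℕ → Subset n → Bool

  open AlgState

  module Run (τ ζ δ : ℚ) (I : Subset n) where

    above : Fin n → Subset n
    above v = tabulate (λ x → toℕ v ℕ.<ᵇ toℕ x)

    inB : Fin n → Bool
    inB v = not ((ζ * avgDeg) ≤ᵇ ℕ→ℚ (degV v))

    -- weak threshold θ_s(σ) (used only for 1 ≤ |σ| ≤ s)
    θ : ℕ → Subset n → ℚ
    θ s σ with ∣ σ ∣
    ... | 1 = (τ ^ℚ (r ∸ s)) * ℕ→ℚ (deg σ)
    ... | k = δ * avgDeg * (τ ^ℚ ((r ∸ s) ℕ.+ k ∸ 1))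

    avoids : (Subset n → Bool) → Subset n → Bool
    avoids Γs f = all (λ σ → not (Γs σ ∧ does (σ ⊆? f))) (allSubsets n)

    F : AlgState → Fin n → ℕ → List (Subset n)
    F st v s =
      filter (λ f → T? (avoids (Γ st s) f))
        (filter (λ f → ∣ f ∣ ℕ.≟ s)
          (filter (λ f → f ⊆? above v)
            (map (λ e → e ─ ⁅ v ⁆)
              (filter (λ e → v ∈? e) (P st (suc s))))))

    -- s = 1, …, r-1
    levels : List ℕ
    levels = applyUpTo suc (r ∸ 1)

    condition : AlgState → Fin n → Bool
    condition st v =
      any (λ s → (ζ * (τ ^ℚ (r ∸ s ∸ 1)) * ℕ→ℚ (degV v)) ≤ᵇ ℕ→ℚ (length (F st v s))) levels
      ∨ Γ st 1 ⁅ v ⁆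

    updateLevel : Fin n → AlgState → ℕ → AlgState
    updateLevel v st s = record
      { T = T st
      ; P = λ t → if t ℕ.≡ᵇ s then newPs else P st t
      ; Γ = λ t σ → if t ℕ.≡ᵇ s then (Γ st s σ ∨ newΓ σ) else Γ st t σ
      }
      where
      newPs : List (Subset n)
      newPs = P st s ++ F st v s
      newΓ : Subset n → Bool
      newΓ σ = does (σ ⊆? above v) ∧ (1 ℕ.≤ᵇ ∣ σ ∣) ∧ (∣ σ ∣ ℕ.≤ᵇ s)
               ∧ (θ s σ ≤ᵇ ℕ→ℚ (degIn newPs σ))

    addToT : Fin n → Subset n → Subset n
    addToT v U = tabulate (λ x → does (x ∈? U) ∨ does (toℕ x ℕ.≟ toℕ v))

    step : AlgState → Fin n → AlgState
    step st v =
      if not (inB v) ∧ condition st v ∧ does (v ∈? I)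
      then foldl (updateLevel v) (record st { T = addToT v (T st) }) levels
      else st

    initial : AlgState
    initial = record
      { T = ⊥
      ; P = λ s → if s ℕ.≡ᵇ r then edges G else []
      ; Γ = λ _ _ → false
      }

    final : AlgState
    final = foldl step initial (allFin n)

    outT : Subset n
    outT = T final

    Γ₁vertices : Subset n
    Γ₁vertices = tabulate (λ v → Γ final 1 ⁅ v ⁆)

-- A vertex v that ends in T but not in Γ₁ was added because some level s had |F_{v,s}| ≥ ζτ^{r-s-1}d(v),
-- and F_{v,s} is then appended to P_s; so the weight Σ_s τ^s |P_s| grows by at least τ^{r-1}ζ d(v) for
-- every such v. Conversely the thresholds cap the multisets: σ is put into Γ_s as soon as d_s(σ) ≥ θ_s(σ),
-- after which it receives no further members of P_s. The last batch adds at most d_{s+1}(σ ∪ {v}), so by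
-- induction down from P_r = E(G) one gets d_s(σ) ≤ θ_s(σ) + (r-s)δdτ^{r-s+|σ|-1}. Summing this over the
-- singletons gives τ^s |P_s| ≤ τ^r nd(1 + rδ), and comparing the two estimates over the r-1 levels
-- yields μ(T ∖ Γ₁) ≤ (r-1)(τ/ζ)(1 + rδ).

module Submission where

open import Defs
open import Algebra.Properties.CommutativeSemigroup using (interchange)
open import Data.Bool using (Bool; true; false; T; T?; not; _∧_; _∨_; if_then_else_)
open import Data.Bool.ListAction using (and; any)
open import Data.Bool.Properties using (T-≡; T-∧; T-∨; T-not-≡)
open import Data.Fin as Fin using (Fin)
import Data.Fin.Properties as FinP
open import Data.Fin.Subset using (Subset; ⁅_⁆; _∈_; _∉_; _⊆_; ∣_∣; _─_; _∪_; ⊥; ⊤; Nonempty)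
open import Data.Fin.Subset.Properties
  using (_∈?_; _⊆?_; ⊆-trans; x∈⁅y⁆⇒x≡y; ∣⁅x⁆∣≡1; x∈p∪q⁻; ∪-identityʳ; nonempty?; Empty-unique
        ; ∣⊥∣≡0; ∣⊤∣≡n; ∣p∣≤n; ∉⊥)
import Data.Integer as ℤ
open import Data.Integer using () renaming (+_ to ℤ⁺)
import Data.Integer.Properties as ℤP
open import Data.List using (List; []; _∷_; _++_; map; filter; length; foldr; foldl; allFin; applyUpTo)
import Data.List.Properties as ListP
open import Data.List.Membership.Propositional using (find) renaming (_∈_ to _∈ˡ_)
import Data.List.Membership.Propositional.Properties as ∈P
open import Data.List.Relation.Binary.Sublist.Propositional.Properties using (length-mono-≤; filter⁺; filter-⊆)
open import Data.List.Relation.Unary.All as All using (All)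
open import Data.List.Relation.Unary.All.Properties using (¬Any⇒All¬; all⁺; ++⁺)
open import Data.List.Relation.Unary.AllPairs using (_∷_)
open import Data.List.Relation.Unary.Any using (here; there; any?)
open import Data.List.Relation.Unary.Any.Properties using (any⁻)
open import Data.List.Relation.Unary.Unique.Propositional using (Unique)
open import Data.List.Relation.Unary.Unique.Propositional.Properties using (allFin⁺)
open import Data.Nat as ℕ using (ℕ; zero; suc; _∸_; _≤_; z≤n; s≤s)
open import Data.Nat.ListAction using (sum)
import Data.Nat.Properties as ℕP
open import Data.Product using (∃-syntax; _×_; _,_; proj₁; proj₂)
open import Data.Rational as ℚ using (ℚ; 0ℚ; 1ℚ; _+_; _-_; _*_; _<_; _÷_; >-nonZero) renaming (_≤_ to _≤ℚ_)
import Data.Rational.Properties as ℚP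
import Data.Rational.Solver
open import Data.Rational.Unnormalised as ℚᵘ using (mkℚᵘ; *≡*)
import Data.Rational.Unnormalised.Properties as ℚᵘP
open import Data.Sum as Sum using (_⊎_; inj₁; inj₂)
open import Data.Vec using (tabulate; []; _∷_; here; there)
import Data.Vec.Properties as VecP
open import Function using (Equivalence; _∘_; id)
open import Level using (0ℓ)
open import Relation.Binary.PropositionalEquality
open import Relation.Nullary using (¬_; Dec; yes; no; does; contradiction)
open import Relation.Nullary.Decidable using (dec-true)
open import Relation.Unary using (Pred; Decidable)

module RS = Data.Rational.Solver.+-*-Solver

private variable
  A B : Set
  n : ℕ

if-≡ᵇ-refl : ∀ s (x y : A) → (if s ℕ.≡ᵇ s then x else y) ≡ x
if-≡ᵇ-refl zero    x y = refl
if-≡ᵇ-refl (suc s) x y = if-≡ᵇ-refl s x y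

if-≡ᵇ-≢ : ∀ {t s} (x y : A) → t ≢ s → (if t ℕ.≡ᵇ s then x else y) ≡ y
if-≡ᵇ-≢ {t = zero}  {zero}  x y t≢s = contradiction refl t≢s
if-≡ᵇ-≢ {t = zero}  {suc s} x y t≢s = refl
if-≡ᵇ-≢ {t = suc t} {zero}  x y t≢s = refl
if-≡ᵇ-≢ {t = suc t} {suc s} x y t≢s = if-≡ᵇ-≢ x y (t≢s ∘ cong suc)

∸-suc : ∀ {m n} → n ℕ.< m → m ∸ n ≡ suc (m ∸ suc n)
∸-suc {suc m} {zero}  _         = refl
∸-suc {suc m} {suc n} (s≤s n<m) = ∸-suc n<m

∈-applyUpTo-suc⁻ : ∀ {m x} → x ∈ˡ applyUpTo suc m → 1 ≤ x × x ≤ m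
∈-applyUpTo-suc⁻ x∈ with i , i<m , refl ← ∈P.∈-applyUpTo⁻ suc x∈ = s≤s z≤n , i<m

1≤m≤n∸1⇒m<n : ∀ {m n} → 1 ≤ m → m ≤ n ∸ 1 → m ℕ.< n
1≤m≤n∸1⇒m<n {n = zero}  1≤m m≤0 = contradiction (ℕP.≤-trans 1≤m m≤0) λ ()
1≤m≤n∸1⇒m<n {n = suc n} 1≤m m≤n = s≤s m≤n

m+[n∸m∸1]≡n∸1 : ∀ {m n} → m ℕ.< n → m ℕ.+ (n ∸ m ∸ 1) ≡ n ∸ 1
m+[n∸m∸1]≡n∸1 {m} {suc n} (s≤s m≤n) = trans (cong (λ k → m ℕ.+ (k ∸ 1)) (∸-suc (s≤s m≤n))) (ℕP.m+[n∸m]≡n m≤n)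

-- ℕ→ℚ k and frac a (suc b) are fromℚᵘ of the unnormalised k/1 and a/(1+b), so their arithmetic
-- is checked in ℚᵘ, where it is integer arithmetic on numerators and denominators.
toℚᵘ-ℕ→ℚ : ∀ k → ℚ.toℚᵘ (ℕ→ℚ k) ℚᵘ.≃ mkℚᵘ (ℤ⁺ k) 0
toℚᵘ-ℕ→ℚ k = ℚP.toℚᵘ-fromℚᵘ (mkℚᵘ (ℤ⁺ k) 0)

ℕ→ℚ-+ : ∀ a b → ℕ→ℚ (a ℕ.+ b) ≡ ℕ→ℚ a + ℕ→ℚ b
ℕ→ℚ-+ a b = ℚP.toℚᵘ-injective (begin
  ℚ.toℚᵘ (ℕ→ℚ (a ℕ.+ b))                 ≈⟨ toℚᵘ-ℕ→ℚ (a ℕ.+ b) ⟩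
  mkℚᵘ (ℤ⁺ (a ℕ.+ b)) 0                  ≈⟨ *≡* +[a+b]≡+a++b ⟩
  mkℚᵘ (ℤ⁺ a) 0 ℚᵘ.+ mkℚᵘ (ℤ⁺ b) 0       ≈⟨ ℚᵘP.+-cong (toℚᵘ-ℕ→ℚ a) (toℚᵘ-ℕ→ℚ b) ⟨
  ℚ.toℚᵘ (ℕ→ℚ a) ℚᵘ.+ ℚ.toℚᵘ (ℕ→ℚ b)    ≈⟨ ℚP.toℚᵘ-homo-+ (ℕ→ℚ a) (ℕ→ℚ b) ⟨
  ℚ.toℚᵘ (ℕ→ℚ a + ℕ→ℚ b)                ∎)
  where
  open ℚᵘP.≃-Reasoning
  +[a+b]≡+a++b : ℤ⁺ (a ℕ.+ b) ℤ.* ℤ⁺ 1 ≡ (ℤ⁺ a ℤ.* ℤ⁺ 1 ℤ.+ ℤ⁺ b ℤ.* ℤ⁺ 1) ℤ.* ℤ⁺ 1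
  +[a+b]≡+a++b = trans (ℤP.*-identityʳ _) (trans (ℤP.pos-+ a b) (sym (trans (ℤP.*-identityʳ _)
                   (cong₂ ℤ._+_ (ℤP.*-identityʳ (ℤ⁺ a)) (ℤP.*-identityʳ (ℤ⁺ b))))))

ℕ→ℚ-suc-* : ∀ m x → ℕ→ℚ (suc m) * x ≡ x + ℕ→ℚ m * x
ℕ→ℚ-suc-* m x = begin
  ℕ→ℚ (suc m) * x        ≡⟨ cong (_* x) (ℕ→ℚ-+ 1 m) ⟩
  (1ℚ + ℕ→ℚ m) * x       ≡⟨ ℚP.*-distribʳ-+ x 1ℚ (ℕ→ℚ m) ⟩
  1ℚ * x + ℕ→ℚ m * x     ≡⟨ cong (_+ ℕ→ℚ m * x) (ℚP.*-identityˡ x) ⟩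
  x + ℕ→ℚ m * x          ∎
  where open ≡-Reasoning

0≤ℕ→ℚ : ∀ k → 0ℚ ≤ℚ ℕ→ℚ k
0≤ℕ→ℚ k = ℚP.nonNegative⁻¹ _ {{ℚP.normalize-nonNeg k 1}}

ℕ→ℚ-mono-≤ : ∀ {a b} → a ≤ b → ℕ→ℚ a ≤ℚ ℕ→ℚ b
ℕ→ℚ-mono-≤ {a} {b} a≤b = begin
  ℕ→ℚ a                   ≤⟨ ℚP.≤-reflexive (sym (ℚP.+-identityʳ (ℕ→ℚ a))) ⟩
  ℕ→ℚ a + 0ℚ              ≤⟨ ℚP.+-monoʳ-≤ (ℕ→ℚ a) (0≤ℕ→ℚ (b ∸ a)) ⟩
  ℕ→ℚ a + ℕ→ℚ (b ∸ a)     ≡⟨ ℕ→ℚ-+ a (b ∸ a) ⟨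
  ℕ→ℚ (a ℕ.+ (b ∸ a))     ≡⟨ cong ℕ→ℚ (ℕP.m+[n∸m]≡n a≤b) ⟩
  ℕ→ℚ b                   ∎
  where open ℚP.≤-Reasoning

0<frac⇒0<args : ∀ a b → 0ℚ < frac a b → 0ℚ < ℕ→ℚ a × 0ℚ < ℕ→ℚ b
0<frac⇒0<args (suc a) (suc b) _ = ℚP.positive⁻¹ _ {{ℚP.normalize-pos (suc a) 1}} , ℚP.positive⁻¹ _ {{ℚP.normalize-pos (suc b) 1}}
0<frac⇒0<args zero    (suc b) 0<0/b = contradiction (subst (0ℚ <_) (ℚP.0/n≡0 (suc b)) 0<0/b) (ℚP.<-irrefl refl)
0<frac⇒0<args a       zero    0<0   = contradiction 0<0 (ℚP.<-irrefl refl)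

frac-*-cancelʳ : ∀ a b → 0ℚ < ℕ→ℚ b → frac a b * ℕ→ℚ b ≡ ℕ→ℚ a
frac-*-cancelʳ a zero    0<0 = contradiction 0<0 (ℚP.<-irrefl refl)
frac-*-cancelʳ a (suc b) _   = ℚP.toℚᵘ-injective (begin
  ℚ.toℚᵘ (frac a (suc b) * ℕ→ℚ (suc b))               ≈⟨ ℚP.toℚᵘ-homo-* (frac a (suc b)) (ℕ→ℚ (suc b)) ⟩
  ℚ.toℚᵘ (frac a (suc b)) ℚᵘ.* ℚ.toℚᵘ (ℕ→ℚ (suc b))
    ≈⟨ ℚᵘP.*-cong (ℚP.toℚᵘ-fromℚᵘ (mkℚᵘ (ℤ⁺ a) b)) (toℚᵘ-ℕ→ℚ (suc b)) ⟩
  mkℚᵘ (ℤ⁺ a) b ℚᵘ.* mkℚᵘ (ℤ⁺ (suc b)) 0              ≈⟨ *≡* (ℤP.*-assoc (ℤ⁺ a) (ℤ⁺ (suc b)) (ℤ⁺ 1)) ⟩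
  mkℚᵘ (ℤ⁺ a) 0                                       ≈⟨ toℚᵘ-ℕ→ℚ a ⟨
  ℚ.toℚᵘ (ℕ→ℚ a)                                      ∎)
  where open ℚᵘP.≃-Reasoning

0≤* : ∀ {a b} → 0ℚ ≤ℚ a → 0ℚ ≤ℚ b → 0ℚ ≤ℚ a * b
0≤* {a} {b} 0≤a 0≤b = ℚP.nonNegative⁻¹ _ {{ℚP.nonNeg*nonNeg⇒nonNeg a {{ℚ.nonNegative 0≤a}} b {{ℚ.nonNegative 0≤b}}}}

0<* : ∀ {a b} → 0ℚ < a → 0ℚ < b → 0ℚ < a * b
0<* {a} {b} 0<a 0<b = ℚP.positive⁻¹ _ {{ℚP.pos*pos⇒pos a {{ℚ.positive 0<a}} b {{ℚ.positive 0<b}}}}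

*-monoˡ-≤-0≤ : ∀ {c a b} → 0ℚ ≤ℚ c → a ≤ℚ b → c * a ≤ℚ c * b
*-monoˡ-≤-0≤ {c} 0≤c = ℚP.*-monoˡ-≤-nonNeg c {{ℚ.nonNegative 0≤c}}

*-monoʳ-≤-0≤ : ∀ {c a b} → 0ℚ ≤ℚ c → a ≤ℚ b → a * c ≤ℚ b * c
*-monoʳ-≤-0≤ {c} 0≤c = ℚP.*-monoʳ-≤-nonNeg c {{ℚ.nonNegative 0≤c}}

*-cancelʳ-≤-0< : ∀ {c a b} → 0ℚ < c → a * c ≤ℚ b * c → a ≤ℚ b
*-cancelʳ-≤-0< {c} 0<c = ℚP.*-cancelʳ-≤-pos c {{ℚ.positive 0<c}}

0<^ℚ : ∀ {τ} → 0ℚ < τ → ∀ k → 0ℚ < τ ^ℚ k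
0<^ℚ 0<τ zero    = ℚP.positive⁻¹ 1ℚ
0<^ℚ 0<τ (suc k) = 0<* 0<τ (0<^ℚ 0<τ k)

0≤^ℚ : ∀ {τ} → 0ℚ ≤ℚ τ → ∀ k → 0ℚ ≤ℚ τ ^ℚ k
0≤^ℚ 0≤τ zero    = ℚP.nonNegative⁻¹ 1ℚ
0≤^ℚ 0≤τ (suc k) = 0≤* 0≤τ (0≤^ℚ 0≤τ k)

^ℚ-+ : ∀ τ a b → τ ^ℚ (a ℕ.+ b) ≡ τ ^ℚ a * τ ^ℚ b
^ℚ-+ τ zero    b = sym (ℚP.*-identityˡ _)
^ℚ-+ τ (suc a) b = trans (cong (τ *_) (^ℚ-+ τ a b)) (sym (ℚP.*-assoc τ _ _))

^ℚ-split : ∀ τ z x {s r} → s ℕ.< r → τ ^ℚ (r ∸ 1) * z * x ≡ τ ^ℚ s * (z * τ ^ℚ (r ∸ s ∸ 1) * x)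
^ℚ-split τ z x {s} {r} s<r = begin
  τ ^ℚ (r ∸ 1) * z * x                ≡⟨ cong (λ k → τ ^ℚ k * z * x) (m+[n∸m∸1]≡n∸1 s<r) ⟨
  τ ^ℚ (s ℕ.+ (r ∸ s ∸ 1)) * z * x    ≡⟨ cong (λ t → t * z * x) (^ℚ-+ τ s (r ∸ s ∸ 1)) ⟩
  τ ^ℚ s * τ ^ℚ (r ∸ s ∸ 1) * z * x   ≡⟨ RS.solve 4 (λ a b z x → a RS.:* b RS.:* z RS.:* x RS.:= a RS.:* (z RS.:* b RS.:* x)) refl
                                           (τ ^ℚ s) (τ ^ℚ (r ∸ s ∸ 1)) z x ⟩
  τ ^ℚ s * (z * τ ^ℚ (r ∸ s ∸ 1) * x) ∎
  where open ≡-Reasoning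

length-filter-filter : ∀ {P Q : Pred A 0ℓ} (P? : Decidable P) (Q? : Decidable Q) xs →
  length (filter P? (filter Q? xs)) ≤ length (filter P? xs)
length-filter-filter P? Q? xs = length-mono-≤ (filter⁺ P? P? (λ { refl p → p }) (filter-⊆ Q? xs))

length-filter-map-filter : ∀ {R : Pred A 0ℓ} {P : Pred B 0ℓ} {Q : Pred A 0ℓ}
  (R? : Decidable R) (P? : Decidable P) (Q? : Decidable Q) (h : A → B) →
  (∀ x → R x → P (h x) → Q x) → ∀ xs →
  length (filter P? (map h (filter R? xs))) ≤ length (filter Q? xs)
length-filter-map-filter R? P? Q? h R∧Ph⇒Q [] = z≤n
length-filter-map-filter R? P? Q? h R∧Ph⇒Q (x ∷ xs) with R? x | Q? x
... | no _   | yes _ = ℕP.m≤n⇒m≤1+n (length-filter-map-filter R? P? Q? h R∧Ph⇒Q xs)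
... | no _   | no _  = length-filter-map-filter R? P? Q? h R∧Ph⇒Q xs
... | yes rx | qx with P? (h x) | qx
...   | yes phx | yes _  = s≤s (length-filter-map-filter R? P? Q? h R∧Ph⇒Q xs)
...   | yes phx | no ¬qx = contradiction (R∧Ph⇒Q x rx phx) ¬qx
...   | no _    | yes _  = ℕP.m≤n⇒m≤1+n (length-filter-map-filter R? P? Q? h R∧Ph⇒Q xs)
...   | no _    | no _   = length-filter-map-filter R? P? Q? h R∧Ph⇒Q xs

sum-map-+ : ∀ (f g : A → ℕ) xs → sum (map (λ x → f x ℕ.+ g x) xs) ≡ sum (map f xs) ℕ.+ sum (map g xs)
sum-map-+ f g []       = refl
sum-map-+ f g (x ∷ xs) = trans (cong (f x ℕ.+ g x ℕ.+_) (sum-map-+ f g xs)) (interchange ℕP.+-commutativeSemigroup (f x) (g x) _ _)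

∈⇒≤sum : ∀ (f : A → ℕ) {x xs} → x ∈ˡ xs → f x ≤ sum (map f xs)
∈⇒≤sum f (here refl) = ℕP.m≤m+n _ _
∈⇒≤sum f {xs = y ∷ _} (there x∈xs) = ℕP.≤-trans (∈⇒≤sum f x∈xs) (ℕP.m≤n+m _ (f y))

sumℚ : List ℚ → ℚ
sumℚ = foldr _+_ 0ℚ

ℕ→ℚ-sum : ∀ (f : A → ℕ) xs → ℕ→ℚ (sum (map f xs)) ≡ sumℚ (map (ℕ→ℚ ∘ f) xs)
ℕ→ℚ-sum f []       = refl
ℕ→ℚ-sum f (x ∷ xs) = trans (ℕ→ℚ-+ (f x) _) (cong (ℕ→ℚ (f x) +_) (ℕ→ℚ-sum f xs))

sumℚ-0≤ : ∀ (f : A → ℚ) xs → (∀ x → 0ℚ ≤ℚ f x) → 0ℚ ≤ℚ sumℚ (map f xs)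
sumℚ-0≤ f []       _   = ℚP.≤-refl
sumℚ-0≤ f (x ∷ xs) 0≤f = ℚP.+-mono-≤ (0≤f x) (sumℚ-0≤ f xs 0≤f)

sumℚ-mono : ∀ (f g : A → ℚ) xs → (∀ x → f x ≤ℚ g x) → sumℚ (map f xs) ≤ℚ sumℚ (map g xs)
sumℚ-mono f g []       _   = ℚP.≤-refl
sumℚ-mono f g (x ∷ xs) f≤g = ℚP.+-mono-≤ (f≤g x) (sumℚ-mono f g xs f≤g)

sumℚ-mono-+ : ∀ (f g : A → ℚ) {c x xs} → (∀ y → f y ≤ℚ g y) → x ∈ˡ xs → f x + c ≤ℚ g x →
  sumℚ (map f xs) + c ≤ℚ sumℚ (map g xs)
sumℚ-mono-+ f g {c} {xs = x ∷ xs} f≤g (here refl) fx+c≤gx = begin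
  f x + sumℚ (map f xs) + c   ≡⟨ ℚP.+-assoc (f x) _ c ⟩
  f x + (sumℚ (map f xs) + c) ≡⟨ cong (f x +_) (ℚP.+-comm _ c) ⟩
  f x + (c + sumℚ (map f xs)) ≡⟨ ℚP.+-assoc (f x) c _ ⟨
  f x + c + sumℚ (map f xs)   ≤⟨ ℚP.+-mono-≤ fx+c≤gx (sumℚ-mono f g xs f≤g) ⟩
  g x + sumℚ (map g xs)       ∎
  where open ℚP.≤-Reasoning
sumℚ-mono-+ f g {c} {xs = y ∷ xs} f≤g (there x∈xs) fx+c≤gx = begin
  f y + sumℚ (map f xs) + c   ≡⟨ ℚP.+-assoc (f y) _ c ⟩
  f y + (sumℚ (map f xs) + c) ≤⟨ ℚP.+-mono-≤ (f≤g y) (sumℚ-mono-+ f g f≤g x∈xs fx+c≤gx) ⟩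
  g y + sumℚ (map g xs)       ∎
  where open ℚP.≤-Reasoning

sumℚ-≤-length-* : ∀ (f : A → ℚ) xs K → (∀ {x} → x ∈ˡ xs → f x ≤ℚ K) → sumℚ (map f xs) ≤ℚ ℕ→ℚ (length xs) * K
sumℚ-≤-length-* f []       K _   = ℚP.≤-reflexive (sym (ℚP.*-zeroˡ K))
sumℚ-≤-length-* f (x ∷ xs) K f≤K = begin
  f x + sumℚ (map f xs)       ≤⟨ ℚP.+-mono-≤ (f≤K (here refl)) (sumℚ-≤-length-* f xs K (f≤K ∘ there)) ⟩
  K + ℕ→ℚ (length xs) * K     ≡⟨ ℕ→ℚ-suc-* (length xs) K ⟨
  ℕ→ℚ (length (x ∷ xs)) * K   ∎
  where open ℚP.≤-Reasoning

sumℚ-affine : ∀ (f : A → ℕ) k c xs →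
  sumℚ (map (λ x → k * ℕ→ℚ (f x) + c) xs) ≡ k * ℕ→ℚ (sum (map f xs)) + ℕ→ℚ (length xs) * c
sumℚ-affine f k c []       = solve 2 (λ k c → con 0ℚ := k :* con 0ℚ :+ con 0ℚ :* c) refl k c
  where open RS
sumℚ-affine f k c (x ∷ xs) = begin
  k * ℕ→ℚ (f x) + c + sumℚ (map (λ x → k * ℕ→ℚ (f x) + c) xs)
    ≡⟨ cong (k * ℕ→ℚ (f x) + c +_) (sumℚ-affine f k c xs) ⟩
  k * ℕ→ℚ (f x) + c + (k * ℕ→ℚ (sum (map f xs)) + ℕ→ℚ (length xs) * c)
    ≡⟨ solve 5 (λ k a c b l → k :* a :+ c :+ (k :* b :+ l :* c) := k :* (a :+ b) :+ (c :+ l :* c)) refl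
         k (ℕ→ℚ (f x)) c (ℕ→ℚ (sum (map f xs))) (ℕ→ℚ (length xs)) ⟩
  k * (ℕ→ℚ (f x) + ℕ→ℚ (sum (map f xs))) + (c + ℕ→ℚ (length xs) * c)
    ≡⟨ cong₂ (λ a b → k * a + b) (ℕ→ℚ-+ (f x) _) (ℕ→ℚ-suc-* (length xs) c) ⟨
  k * ℕ→ℚ (sum (map f (x ∷ xs))) + ℕ→ℚ (length (x ∷ xs)) * c ∎
  where
  open ≡-Reasoning
  open RS

∈─⁻ : ∀ {x : Fin n} p q → x ∈ p ─ q → x ∈ p × x ∉ q
∈─⁻ {x = Fin.zero} (true ∷ p)  (false ∷ q) here = here , λ ()
∈─⁻ {x = Fin.zero} (_ ∷ p)     (true ∷ q)  ()
∈─⁻ {x = Fin.zero} (false ∷ p) (false ∷ q) ()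
∈─⁻ (_ ∷ p)     (_ ∷ q)     (there x) = let x∈p , x∉q = ∈─⁻ p q x in there x∈p , λ { (there x∈q) → x∉q x∈q }

∈─⁺ : ∀ {x : Fin n} p q → x ∈ p → x ∉ q → x ∈ p ─ q
∈─⁺ (true ∷ p) (false ∷ q) here      x∉q = here
∈─⁺ (true ∷ p) (true ∷ q)  here      x∉q = contradiction here x∉q
∈─⁺ (_ ∷ p)    (false ∷ q) (there x) x∉q = there (∈─⁺ p q x (x∉q ∘ there))
∈─⁺ (_ ∷ p)    (true ∷ q)  (there x) x∉q = there (∈─⁺ p q x (x∉q ∘ there))

∣p∪⁅x⁆∣≡1+∣p∣ : ∀ (p : Subset n) x → x ∉ p → ∣ p ∪ ⁅ x ⁆ ∣ ≡ suc ∣ p ∣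
∣p∪⁅x⁆∣≡1+∣p∣ (true ∷ p)  Fin.zero    x∉p = contradiction here x∉p
∣p∪⁅x⁆∣≡1+∣p∣ (false ∷ p) Fin.zero    x∉p = cong (suc ∘ ∣_∣) (∪-identityʳ p)
∣p∪⁅x⁆∣≡1+∣p∣ (true ∷ p)  (Fin.suc x) x∉p = cong suc (∣p∪⁅x⁆∣≡1+∣p∣ p x (x∉p ∘ there))
∣p∪⁅x⁆∣≡1+∣p∣ (false ∷ p) (Fin.suc x) x∉p = ∣p∪⁅x⁆∣≡1+∣p∣ p x (x∉p ∘ there)

1≤∣p∣⇒Nonempty : ∀ {n} (p : Subset n) → 1 ≤ ∣ p ∣ → Nonempty p
1≤∣p∣⇒Nonempty {n} p 1≤∣p∣ with nonempty? p
... | yes ne = ne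
... | no ¬ne = contradiction (trans (cong ∣_∣ (Empty-unique ¬ne)) (∣⊥∣≡0 n)) (ℕP.m<n⇒n≢0 1≤∣p∣)

x∈p⇒⁅x⁆⊆p : ∀ {x : Fin n} {p} → x ∈ p → ⁅ x ⁆ ⊆ p
x∈p⇒⁅x⁆⊆p {x = x} x∈p y∈⁅x⁆ rewrite x∈⁅y⁆⇒x≡y x y∈⁅x⁆ = x∈p

∈-tabulate⁻ : ∀ (g : Fin n → Bool) {x} → x ∈ tabulate g → T (g x)
∈-tabulate⁻ g {x} x∈ = Equivalence.from T-≡ (trans (sym (VecP.lookup∘tabulate g x)) (VecP.[]=⇒lookup x∈))

∈-tabulate⁺ : ∀ (g : Fin n → Bool) {x} → T (g x) → x ∈ tabulate g
∈-tabulate⁺ g {x} gx = VecP.lookup⇒[]= x (tabulate g) (trans (VecP.lookup∘tabulate g x) (Equivalence.to T-≡ gx))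

∈-allSubsets : ∀ (σ : Subset n) → σ ∈ˡ allSubsets n
∈-allSubsets []            = here refl
∈-allSubsets {suc n} (false ∷ σ) = ∈P.∈-++⁺ˡ (∈P.∈-map⁺ (false ∷_) (∈-allSubsets σ))
∈-allSubsets {suc n} (true ∷ σ)  = ∈P.∈-++⁺ʳ (map (false ∷_) (allSubsets n)) (∈P.∈-map⁺ (true ∷_) (∈-allSubsets σ))

sumOver : (Fin n → ℕ) → Subset n → List (Fin n) → ℕ
sumOver w U xs = sum (map w (filter (_∈? U) xs))

sumOver-mono : ∀ (w : Fin n → ℕ) {U U′} xs → All (λ u → u ∈ U → u ∈ U′) xs → sumOver w U xs ≤ sumOver w U′ xs
sumOver-mono w         []       All.[]               = z≤n
sumOver-mono w {U} {U′} (x ∷ xs) (U⇒U′ All.∷ rest) with x ∈? U | x ∈? U′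
... | yes _   | yes _    = ℕP.+-monoʳ-≤ (w x) (sumOver-mono w xs rest)
... | yes x∈U | no x∉U′  = contradiction (U⇒U′ x∈U) x∉U′
... | no _    | yes _    = ℕP.≤-trans (sumOver-mono w xs rest) (ℕP.m≤n+m _ (w x))
... | no _    | no _     = sumOver-mono w xs rest

sumOver-⊆∪⁅⁆ : ∀ (w : Fin n → ℕ) {U U′ v} xs → Unique xs → (∀ {u} → u ∈ U → u ∈ U′ ⊎ u ≡ v) →
  sumOver w U xs ≤ sumOver w U′ xs ℕ.+ w v
sumOver-⊆∪⁅⁆ w         []       _                  _      = z≤n
sumOver-⊆∪⁅⁆ w {U} {U′} {v} (x ∷ xs) (x∉xs ∷ unique) U⊆U′∪v with x ∈? U | x ∈? U′
... | yes _ | yes _ = subst (w x ℕ.+ sumOver w U xs ≤_) (sym (ℕP.+-assoc (w x) _ (w v)))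
                        (ℕP.+-monoʳ-≤ (w x) (sumOver-⊆∪⁅⁆ w xs unique U⊆U′∪v))
... | no _  | yes _ = ℕP.≤-trans (sumOver-⊆∪⁅⁆ w xs unique U⊆U′∪v) (ℕP.+-monoˡ-≤ (w v) (ℕP.m≤n+m _ (w x)))
... | no _  | no _  = sumOver-⊆∪⁅⁆ w xs unique U⊆U′∪v
... | yes x∈U | no x∉U′ with U⊆U′∪v x∈U
...   | inj₁ x∈U′ = contradiction x∈U′ x∉U′
...   | inj₂ refl = subst (w x ℕ.+ sumOver w U xs ≤_) (ℕP.+-comm (w x) _)
                      (ℕP.+-monoʳ-≤ (w x) (sumOver-mono w xs (All.map (λ x≢u u∈U → rest-in-U′ x≢u u∈U) x∉xs)))
  where
  rest-in-U′ : ∀ {u} → x ≢ u → u ∈ U → u ∈ U′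
  rest-in-U′ x≢u u∈U = Sum.[ (λ u∈U′ → u∈U′) , (λ u≡x → contradiction (sym u≡x) x≢u) ] (U⊆U′∪v u∈U)

sumOver-empty : ∀ (w : Fin n → ℕ) {U} xs → (∀ u → u ∉ U) → sumOver w U xs ≡ 0
sumOver-empty w     []       _     = refl
sumOver-empty w {U} (x ∷ xs) empty with x ∈? U
... | yes x∈U = contradiction x∈U (empty x)
... | no _    = sumOver-empty w xs empty

degIn-++ : ∀ (xs ys : List (Subset n)) σ → degIn (xs ++ ys) σ ≡ degIn xs σ ℕ.+ degIn ys σ
degIn-++ xs ys σ = trans (cong length (ListP.filter-++ (σ ⊆?_) xs ys)) (ListP.length-++ (filter (σ ⊆?_) xs))

degIn≡0⊎⊆ : ∀ (Ps : List (Subset n)) σ → degIn Ps σ ≡ 0 ⊎ ∃[ f ] f ∈ˡ Ps × σ ⊆ f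
degIn≡0⊎⊆ Ps σ with any? (σ ⊆?_) Ps
... | yes hit  = inj₂ (find hit)
... | no ¬hit = inj₁ (cong length (ListP.filter-none (σ ⊆?_) (¬Any⇒All¬ Ps ¬hit)))

length≤Σdeg : ∀ {n} (Ps : List (Subset n)) → All (λ f → 1 ≤ ∣ f ∣) Ps →
  length Ps ≤ sum (map (λ u → degIn Ps ⁅ u ⁆) (allFin n))
length≤Σdeg []       _              = z≤n
length≤Σdeg {n} (f ∷ Ps) (1≤∣f∣ All.∷ rest) = begin
  1 ℕ.+ length Ps
    ≤⟨ ℕP.+-mono-≤ f-counted (length≤Σdeg Ps rest) ⟩
  sum (map (λ u → degIn (f ∷ []) ⁅ u ⁆) (allFin n)) ℕ.+ sum (map (λ u → degIn Ps ⁅ u ⁆) (allFin n))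
    ≡⟨ sum-map-+ (λ u → degIn (f ∷ []) ⁅ u ⁆) (λ u → degIn Ps ⁅ u ⁆) (allFin n) ⟨
  sum (map (λ u → degIn (f ∷ []) ⁅ u ⁆ ℕ.+ degIn Ps ⁅ u ⁆) (allFin n))
    ≡⟨ cong sum (ListP.map-cong (λ u → degIn-++ (f ∷ []) Ps ⁅ u ⁆) (allFin n)) ⟨
  sum (map (λ u → degIn (f ∷ Ps) ⁅ u ⁆) (allFin n)) ∎
  where
  open ℕP.≤-Reasoning
  f-counted : 1 ≤ sum (map (λ u → degIn (f ∷ []) ⁅ u ⁆) (allFin n))
  f-counted with u , u∈f ← 1≤∣p∣⇒Nonempty f 1≤∣f∣ = ℕP.≤-trans
    (ℕP.≤-reflexive (cong length (sym (ListP.filter-accept (⁅ u ⁆ ⊆?_) (x∈p⇒⁅x⁆⊆p u∈f)))))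
    (∈⇒≤sum (λ u → degIn (f ∷ []) ⁅ u ⁆) (∈P.∈-allFin u))

IsDelta⇒0≤δ : ∀ {r n} (G : RGraph r n) {τ δ} → 0ℚ < avgDeg G → 0ℚ < τ → IsDelta G τ δ → 0ℚ ≤ℚ δ
IsDelta⇒0≤δ {n = n} G {τ} {δ} 0<d 0<τ isδ with 2 ℕ.≤? n
... | yes 2≤n = *-cancelʳ-≤-0< (0<* 0<d (0<^ℚ 0<τ (n ∸ 1))) (begin
  0ℚ * (avgDeg G * τ ^ℚ (n ∸ 1))  ≡⟨ ℚP.*-zeroˡ (avgDeg G * τ ^ℚ (n ∸ 1)) ⟩
  0ℚ                              ≤⟨ 0≤ℕ→ℚ (deg G ⊤) ⟩
  ℕ→ℚ (deg G ⊤)                   ≤⟨ IsDelta.bound isδ ⊤ (subst (2 ≤_) (sym (∣⊤∣≡n n)) 2≤n) ⟩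
  δ * avgDeg G * τ ^ℚ (∣ ⊤ {n} ∣ ∸ 1) ≡⟨ cong (λ k → δ * avgDeg G * τ ^ℚ (k ∸ 1)) (∣⊤∣≡n n) ⟩
  δ * avgDeg G * τ ^ℚ (n ∸ 1)     ≡⟨ ℚP.*-assoc δ _ _ ⟩
  δ * (avgDeg G * τ ^ℚ (n ∸ 1))   ∎)
  where open ℚP.≤-Reasoning
-- with fewer than two vertices the bound is vacuous, so no δ is minimal
... | no 2≰n = contradiction (ℚP.≤-<-trans (IsDelta.minimal isδ (δ - 1ℚ) vacuous) δ-1<δ) (ℚP.<-irrefl refl)
  where
  vacuous : DeltaBound G τ (δ - 1ℚ)
  vacuous σ 2≤∣σ∣ = contradiction (ℕP.≤-trans 2≤∣σ∣ (∣p∣≤n σ)) 2≰n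
  δ-1<δ : δ - 1ℚ < δ
  δ-1<δ = subst (δ - 1ℚ <_) (ℚP.+-identityʳ δ) (ℚP.+-monoʳ-< δ (ℚP.negative⁻¹ (ℚ.- 1ℚ)))

module Analysis {r n : ℕ} (G : RGraph r n) (τ ζ δ : ℚ) (I : Subset n) where

  open Run G τ ζ δ I
  open AlgState renaming (T to Tₛ)

  d : ℚ
  d = avgDeg G

  Level : ℕ → Set
  Level s = 1 ≤ s × s ℕ.< r

  Small : ℕ → Subset n → Set
  Small s σ = 1 ≤ ∣ σ ∣ × ∣ σ ∣ ≤ s

  Θ : ℕ → ℕ → ℚ
  Θ s k = δ * d * τ ^ℚ ((r ∸ s) ℕ.+ k ∸ 1)

  θ≡Θ : ∀ s σ → 2 ≤ ∣ σ ∣ → θ s σ ≡ Θ s ∣ σ ∣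
  θ≡Θ s σ 2≤∣σ∣ with ∣ σ ∣
  θ≡Θ s σ (s≤s (s≤s _)) | suc (suc k) = refl

  θ⁅⁆ : ∀ s u → θ s ⁅ u ⁆ ≡ τ ^ℚ (r ∸ s) * ℕ→ℚ (degV G u)
  θ⁅⁆ s u with ∣ ⁅ u ⁆ ∣ | ∣⁅x⁆∣≡1 u
  ... | .1 | refl = refl

  Θ-suc : ∀ {s} k → s ℕ.< r → Θ (suc s) (suc k) ≡ Θ s k
  Θ-suc {s} k s<r = cong (λ e → δ * d * τ ^ℚ e) (begin
    (r ∸ suc s) ℕ.+ suc k ∸ 1        ≡⟨ cong (_∸ 1) (ℕP.+-suc (r ∸ suc s) k) ⟩
    (r ∸ suc s) ℕ.+ k                ≡⟨ cong (λ m → m ℕ.+ k ∸ 1) (∸-suc s<r) ⟨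
    (r ∸ s) ℕ.+ k ∸ 1                ∎)
    where open ≡-Reasoning

  record LevelInvariant (st : AlgState G) (s : ℕ) : Set where
    field
      uniform   : All (λ f → ∣ f ∣ ≡ s) (P st s)
      saturated : ∀ {σ} → Small s σ → T (Γ st s σ) ⊎ ℕ→ℚ (degIn (P st s) σ) ≤ℚ θ s σ
      bounded   : ∀ {σ} → Small s σ → ℕ→ℚ (degIn (P st s) σ) ≤ℚ θ s σ + ℕ→ℚ (r ∸ s) * Θ s ∣ σ ∣

  record Invariant (st : AlgState G) : Set where
    field
      top   : P st r ≡ edges G
      level : ∀ {s} → Level s → LevelInvariant st s

  open LevelInvariant
  open Invariant

  LevelInvariant-cong : ∀ {a b s} → P a s ≡ P b s → (∀ σ → Γ a s σ ≡ Γ b s σ) →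
    LevelInvariant a s → LevelInvariant b s
  LevelInvariant-cong {a} {b} {s} Pa≡Pb Γa≡Γb inv = record
    { uniform   = subst (All _) Pa≡Pb (uniform inv)
    ; saturated = λ {σ} small → subst₂ (λ γ Ps → T γ ⊎ ℕ→ℚ (degIn Ps σ) ≤ℚ θ s σ) (Γa≡Γb σ) Pa≡Pb (saturated inv small)
    ; bounded   = λ {σ} small → subst (λ Ps → ℕ→ℚ (degIn Ps σ) ≤ℚ _) Pa≡Pb (bounded inv small)
    }

  module _ (v : Fin n) (st : AlgState G) (s : ℕ) where

    P-updateLevel : P (updateLevel v st s) s ≡ P st s ++ F st v s
    P-updateLevel = if-≡ᵇ-refl s _ _

    P-updateLevel-≢ : ∀ {t} → t ≢ s → P (updateLevel v st s) t ≡ P st t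
    P-updateLevel-≢ = if-≡ᵇ-≢ _ _

    Γ-updateLevel-≢ : ∀ {t} → t ≢ s → ∀ σ → Γ (updateLevel v st s) t σ ≡ Γ st t σ
    Γ-updateLevel-≢ t≢s σ = if-≡ᵇ-≢ _ _ t≢s

    Γ-updateLevel-grow : ∀ {σ} → T (Γ st s σ) → T (Γ (updateLevel v st s) s σ)
    Γ-updateLevel-grow {σ} Γσ =
      subst T (sym (if-≡ᵇ-refl s (Γ st s σ ∨ _) (Γ st s σ))) (Equivalence.from (T-∨ {Γ st s σ}) (inj₁ Γσ))

    Γ-updateLevel-mono : ∀ t {σ} → T (Γ st t σ) → T (Γ (updateLevel v st s) t σ)
    Γ-updateLevel-mono t {σ} Γσ = by-cases (t ℕ.≟ s)
      where
      by-cases : Dec (t ≡ s) → T (Γ (updateLevel v st s) t σ)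
      by-cases (yes refl) = Γ-updateLevel-grow Γσ
      by-cases (no t≢s)   = subst T (sym (Γ-updateLevel-≢ t≢s σ)) Γσ

    Γ-updateLevel-add : ∀ {σ} → σ ⊆ above v → Small s σ →
      θ s σ ≤ℚ ℕ→ℚ (degIn (P (updateLevel v st s) s) σ) → T (Γ (updateLevel v st s) s σ)
    Γ-updateLevel-add {σ} σ⊆above (1≤∣σ∣ , ∣σ∣≤s) θ≤deg =
      subst T (sym (if-≡ᵇ-refl s (Γ st s σ ∨ _) (Γ st s σ))) (Equivalence.from (T-∨ {Γ st s σ}) (inj₂
        (∧-intro (Equivalence.from T-≡ (dec-true (σ ⊆? above v) σ⊆above))
        (∧-intro (ℕP.≤⇒≤ᵇ 1≤∣σ∣)
        (∧-intro (ℕP.≤⇒≤ᵇ ∣σ∣≤s)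
                 (ℚP.≤⇒≤ᵇ (subst (λ Ps → θ s σ ≤ℚ ℕ→ℚ (degIn Ps σ)) P-updateLevel θ≤deg)))))))
      where
      ∧-intro : ∀ {a b} → T a → T b → T (a ∧ b)
      ∧-intro a b = Equivalence.from T-∧ (a , b)

    degIn-updateLevel : ∀ σ → degIn (P (updateLevel v st s) s) σ ≡ degIn (P st s) σ ℕ.+ degIn (F st v s) σ
    degIn-updateLevel σ = trans (cong (λ Ps → degIn Ps σ) P-updateLevel) (degIn-++ (P st s) (F st v s) σ)

    private
      removed inAbove ofSize : List (Subset n)
      removed = map (_─ ⁅ v ⁆) (filter (v ∈?_) (P st (suc s)))
      inAbove = filter (_⊆? above v) removed
      ofSize  = filter (λ f → ∣ f ∣ ℕ.≟ s) inAbove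

    F-member : ∀ {f} → f ∈ˡ F st v s → T (avoids (Γ st s) f) × ∣ f ∣ ≡ s × f ⊆ above v
    F-member f∈F =
      let f∈₁ , avoid   = ∈P.∈-filter⁻ (λ f → T? (avoids (Γ st s) f)) {xs = ofSize} f∈F
          f∈₂ , ∣f∣≡s   = ∈P.∈-filter⁻ (λ f → ∣ f ∣ ℕ.≟ s) {xs = inAbove} f∈₁
          _   , f⊆above = ∈P.∈-filter⁻ (_⊆? above v) {xs = removed} f∈₂
      in avoid , ∣f∣≡s , f⊆above

    degIn-F≤ : ∀ σ → degIn (F st v s) σ ≤ degIn (P st (suc s)) (σ ∪ ⁅ v ⁆)
    degIn-F≤ σ = begin
      degIn (F st v s) σ                ≤⟨ length-filter-filter (σ ⊆?_) (λ f → T? (avoids (Γ st s) f)) ofSize ⟩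
      length (filter (σ ⊆?_) ofSize)    ≤⟨ length-filter-filter (σ ⊆?_) (λ f → ∣ f ∣ ℕ.≟ s) inAbove ⟩
      length (filter (σ ⊆?_) inAbove)   ≤⟨ length-filter-filter (σ ⊆?_) (_⊆? above v) removed ⟩
      length (filter (σ ⊆?_) removed)
        ≤⟨ length-filter-map-filter (v ∈?_) (σ ⊆?_) ((σ ∪ ⁅ v ⁆) ⊆?_) (_─ ⁅ v ⁆) σ∪v⊆e (P st (suc s)) ⟩
      degIn (P st (suc s)) (σ ∪ ⁅ v ⁆)  ∎
      where
      open ℕP.≤-Reasoning
      σ∪v⊆e : ∀ e → v ∈ e → σ ⊆ e ─ ⁅ v ⁆ → σ ∪ ⁅ v ⁆ ⊆ e
      σ∪v⊆e e v∈e σ⊆e-v x∈σ∪v with x∈p∪q⁻ σ ⁅ v ⁆ x∈σ∪v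
      ... | inj₁ x∈σ = proj₁ (∈─⁻ e ⁅ v ⁆ (σ⊆e-v x∈σ))
      ... | inj₂ x∈v rewrite x∈⁅y⁆⇒x≡y v x∈v = v∈e

  avoids⇒¬Γ : ∀ {Γs f σ} → T (avoids Γs f) → σ ⊆ f → ¬ T (Γs σ)
  avoids⇒¬Γ {Γs} {f} {σ} avoid σ⊆f Γσ =
    subst T (Equivalence.to T-not-≡ (All.lookup (all⁺ _ (allSubsets n) avoid) (∈-allSubsets σ)))
      (Equivalence.from T-∧ (Γσ , Equivalence.from T-≡ (dec-true (σ ⊆? f) σ⊆f)))

  v∉above : ∀ v → v ∉ above v
  v∉above v v∈above = ℕP.<-irrefl refl (ℕP.<ᵇ⇒< (Fin.toℕ v) (Fin.toℕ v) (∈-tabulate⁻ _ v∈above))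

  F-cong : ∀ {a b} v s → P a (suc s) ≡ P b (suc s) → (∀ σ → Γ a s σ ≡ Γ b s σ) → F a v s ≡ F b v s
  F-cong {a} {b} v s Pa≡Pb Γa≡Γb = trans
    (cong (λ Ps → filter (λ f → T? (avoids (Γ a s) f)) (candidates Ps)) Pa≡Pb)
    (ListP.filter-≐ (λ f → T? (avoids (Γ a s) f)) (λ f → T? (avoids (Γ b s) f))
      ((λ {f} → subst T (same-avoids f)) , (λ {f} → subst T (sym (same-avoids f))))
      (candidates (P b (suc s))))
    where
    candidates : List (Subset n) → List (Subset n)
    candidates Ps = filter (λ f → ∣ f ∣ ℕ.≟ s) (filter (_⊆? above v) (map (_─ ⁅ v ⁆) (filter (v ∈?_) Ps)))
    same-avoids : ∀ f → avoids (Γ a s) f ≡ avoids (Γ b s) f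
    same-avoids f = cong and (ListP.map-cong (λ σ → cong (λ γ → not (γ ∧ does (σ ⊆? f))) (Γa≡Γb σ)) (allSubsets n))

  module _ (v : Fin n) where

    fold-Tₛ : ∀ ls st → Tₛ (foldl (updateLevel v) st ls) ≡ Tₛ st
    fold-Tₛ []       st = refl
    fold-Tₛ (s ∷ ls) st = fold-Tₛ ls (updateLevel v st s)

    fold-Γ-mono : ∀ ls {st} t {σ} → T (Γ st t σ) → T (Γ (foldl (updateLevel v) st ls) t σ)
    fold-Γ-mono []            t Γσ = Γσ
    fold-Γ-mono (s ∷ ls) {st} t Γσ = fold-Γ-mono ls t (Γ-updateLevel-mono v st s t Γσ)

    fold-length-mono : ∀ ls st t → length (P st t) ≤ length (P (foldl (updateLevel v) st ls) t)
    fold-length-mono []       st t = ℕP.≤-refl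
    fold-length-mono (s ∷ ls) st t = ℕP.≤-trans (by-cases (t ℕ.≟ s)) (fold-length-mono ls (updateLevel v st s) t)
      where
      by-cases : Dec (t ≡ s) → length (P st t) ≤ length (P (updateLevel v st s) t)
      by-cases (yes refl) = ℕP.≤-trans (ℕP.m≤m+n _ _)
        (ℕP.≤-reflexive (sym (trans (cong length (P-updateLevel v st s)) (ListP.length-++ (P st s)))))
      by-cases (no t≢s) = ℕP.≤-reflexive (cong length (sym (P-updateLevel-≢ v st s t≢s)))

    fold-P-untouched : ∀ ls {st t} → All (_≢ t) ls → P (foldl (updateLevel v) st ls) t ≡ P st t
    fold-P-untouched []       All.[]           = refl
    fold-P-untouched (s ∷ ls) {st} (s≢t All.∷ rest) = trans (fold-P-untouched ls rest) (P-updateLevel-≢ v st s (s≢t ∘ sym))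

    fold-Γ-untouched : ∀ ls {st t} → All (_≢ t) ls → ∀ σ → Γ (foldl (updateLevel v) st ls) t σ ≡ Γ st t σ
    fold-Γ-untouched []       All.[]           σ = refl
    fold-Γ-untouched (s ∷ ls) {st} (s≢t All.∷ rest) σ = trans (fold-Γ-untouched ls rest σ) (Γ-updateLevel-≢ v st s (s≢t ∘ sym) σ)

    -- F_{v,t} depends only on P_{t+1} and Γ_t, which the levels 1, …, t-1 processed before t leave untouched
    fold-levels-growth : ∀ m st {t} → 1 ≤ t → t ≤ m →
      length (P st t) ℕ.+ length (F st v t) ≤ length (P (foldl (updateLevel v) st (applyUpTo suc m)) t)
    fold-levels-growth zero    st 1≤t t≤0 = contradiction (ℕP.≤-trans 1≤t t≤0) λ ()
    fold-levels-growth (suc m) st {t} 1≤t t≤1+m =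
      subst (λ ls → length (P st t) ℕ.+ length (F st v t) ≤ length (P (foldl (updateLevel v) st ls) t)) (ListP.applyUpTo-∷ʳ suc m)
        (subst (λ st′ → length (P st t) ℕ.+ length (F st v t) ≤ length (P st′ t))
          (sym (ListP.foldl-∷ʳ (updateLevel v) st (suc m) (applyUpTo suc m))) (by-cases (t ℕ.≟ suc m)))
      where
      before : AlgState G
      before = foldl (updateLevel v) st (applyUpTo suc m)
      untouched-above : ∀ {u} → m ℕ.< u → All (_≢ u) (applyUpTo suc m)
      untouched-above m<u = All.tabulate λ x∈ x≡u → ℕP.<-irrefl x≡u (ℕP.≤-<-trans (proj₂ (∈-applyUpTo-suc⁻ x∈)) m<u)
      by-cases : Dec (t ≡ suc m) → length (P st t) ℕ.+ length (F st v t) ≤ length (P (updateLevel v before (suc m)) t)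
      by-cases (yes refl) = ℕP.≤-reflexive (begin
        length (P st t) ℕ.+ length (F st v t)
          ≡⟨ cong₂ (λ Ps Fs → length Ps ℕ.+ length Fs)
               (fold-P-untouched (applyUpTo suc m) (untouched-above ℕP.≤-refl))
               (F-cong {before} {st} v t (fold-P-untouched (applyUpTo suc m) (untouched-above (ℕP.m≤n⇒m≤1+n ℕP.≤-refl)))
                                         (fold-Γ-untouched (applyUpTo suc m) (untouched-above ℕP.≤-refl))) ⟨
        length (P before t) ℕ.+ length (F before v t)  ≡⟨ ListP.length-++ (P before t) ⟨
        length (P before t ++ F before v t)           ≡⟨ cong length (P-updateLevel v before t) ⟨
        length (P (updateLevel v before t) t)         ∎)
        where open ≡-Reasoning
      by-cases (no t≢1+m) = ℕP.≤-trans
        (fold-levels-growth m st 1≤t (ℕP.≤-pred (ℕP.≤∧≢⇒< t≤1+m t≢1+m)))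
        (ℕP.≤-reflexive (cong length (sym (P-updateLevel-≢ v before (suc m) t≢1+m))))

  module _ (δ-bound : DeltaBound G τ δ) where

    codegree-bound : ∀ {st s} → Invariant st → Level s → ∀ {σ k} → ∣ σ ∣ ≡ suc k → 1 ≤ k → k ≤ s →
      ℕ→ℚ (degIn (P st (suc s)) σ) ≤ℚ ℕ→ℚ (r ∸ s) * Θ s k
    codegree-bound {st} {s} inv (_ , s<r) {σ} {k} ∣σ∣≡1+k 1≤k k≤s = by-cases (suc s ℕ.<? r)
      where
      open ℚP.≤-Reasoning
      2≤∣σ∣ : 2 ≤ ∣ σ ∣
      2≤∣σ∣ = subst (2 ≤_) (sym ∣σ∣≡1+k) (s≤s 1≤k)
      by-cases : Dec (suc s ℕ.< r) → ℕ→ℚ (degIn (P st (suc s)) σ) ≤ℚ ℕ→ℚ (r ∸ s) * Θ s k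
      by-cases (yes 1+s<r) = begin
        ℕ→ℚ (degIn (P st (suc s)) σ)
          ≤⟨ bounded (level inv (s≤s z≤n , 1+s<r)) (ℕP.≤-trans (s≤s z≤n) 2≤∣σ∣ , subst (_≤ suc s) (sym ∣σ∣≡1+k) (s≤s k≤s)) ⟩
        θ (suc s) σ + ℕ→ℚ (r ∸ suc s) * Θ (suc s) ∣ σ ∣
          ≡⟨ cong (_+ ℕ→ℚ (r ∸ suc s) * Θ (suc s) ∣ σ ∣) (θ≡Θ (suc s) σ 2≤∣σ∣) ⟩
        Θ (suc s) ∣ σ ∣ + ℕ→ℚ (r ∸ suc s) * Θ (suc s) ∣ σ ∣
          ≡⟨ ℕ→ℚ-suc-* (r ∸ suc s) (Θ (suc s) ∣ σ ∣) ⟨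
        ℕ→ℚ (suc (r ∸ suc s)) * Θ (suc s) ∣ σ ∣
          ≡⟨ cong₂ (λ m x → ℕ→ℚ m * x) (sym (∸-suc s<r)) (trans (cong (Θ (suc s)) ∣σ∣≡1+k) (Θ-suc k s<r)) ⟩
        ℕ→ℚ (r ∸ s) * Θ s k ∎
      by-cases (no 1+s≮r) = begin
        ℕ→ℚ (degIn (P st (suc s)) σ)   ≡⟨ cong (λ Ps → ℕ→ℚ (degIn Ps σ)) (trans (cong (P st) 1+s≡r) (top inv)) ⟩
        ℕ→ℚ (deg G σ)                  ≤⟨ δ-bound σ 2≤∣σ∣ ⟩
        δ * d * τ ^ℚ (∣ σ ∣ ∸ 1)       ≡⟨ cong (λ e → δ * d * τ ^ℚ e)
                                            (trans (cong (_∸ 1) ∣σ∣≡1+k) (cong (λ m → m ℕ.+ k ∸ 1) (sym r∸s≡1))) ⟩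
        Θ s k                          ≡⟨ ℚP.*-identityˡ (Θ s k) ⟨
        1ℚ * Θ s k                     ≡⟨ cong (λ m → ℕ→ℚ m * Θ s k) r∸s≡1 ⟨
        ℕ→ℚ (r ∸ s) * Θ s k            ∎
        where
        1+s≡r : suc s ≡ r
        1+s≡r = ℕP.≤-antisym s<r (ℕP.≮⇒≥ 1+s≮r)
        r∸s≡1 : r ∸ s ≡ 1
        r∸s≡1 = trans (cong (_∸ s) (sym 1+s≡r)) (ℕP.m+n∸n≡m 1 s)

    module _ {v : Fin n} {st : AlgState G} {s : ℕ} (inv : Invariant st) (lvl : Level s) where
      private
        st′ : AlgState G
        st′ = updateLevel v st s
        old : LevelInvariant st s
        old = level inv lvl

      degIn-untouched : ∀ {σ} → degIn (F st v s) σ ≡ 0 → degIn (P st′ s) σ ≡ degIn (P st s) σ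
      degIn-untouched {σ} none = trans (degIn-updateLevel v st s σ) (trans (cong (degIn (P st s) σ ℕ.+_) none) (ℕP.+-identityʳ _))

      saturated-updateLevel : ∀ {σ} → Small s σ → T (Γ st′ s σ) ⊎ ℕ→ℚ (degIn (P st′ s) σ) ≤ℚ θ s σ
      saturated-updateLevel {σ} small = by-cases (degIn≡0⊎⊆ (F st v s) σ)
        where
        by-cases : degIn (F st v s) σ ≡ 0 ⊎ ∃[ f ] f ∈ˡ F st v s × σ ⊆ f →
          T (Γ st′ s σ) ⊎ ℕ→ℚ (degIn (P st′ s) σ) ≤ℚ θ s σ
        by-cases (inj₁ none) = Sum.map (Γ-updateLevel-grow v st s) (subst (λ k → ℕ→ℚ k ≤ℚ θ s σ) (sym (degIn-untouched none)))
                                 (saturated old small)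
        by-cases (inj₂ (f , f∈F , σ⊆f)) = compare (θ s σ ℚP.≤? ℕ→ℚ (degIn (P st′ s) σ))
          where
          compare : Dec (θ s σ ≤ℚ ℕ→ℚ (degIn (P st′ s) σ)) → T (Γ st′ s σ) ⊎ ℕ→ℚ (degIn (P st′ s) σ) ≤ℚ θ s σ
          compare (yes over) = inj₁ (Γ-updateLevel-add v st s (⊆-trans σ⊆f (proj₂ (proj₂ (F-member v st s f∈F)))) small over)
          compare (no under) = inj₂ (ℚP.<⇒≤ (ℚP.≰⇒> under))

      bounded-updateLevel : ∀ {σ} → Small s σ → ℕ→ℚ (degIn (P st′ s) σ) ≤ℚ θ s σ + ℕ→ℚ (r ∸ s) * Θ s ∣ σ ∣
      bounded-updateLevel {σ} small@(1≤∣σ∣ , ∣σ∣≤s) = by-cases (degIn≡0⊎⊆ (F st v s) σ)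
        where
        by-cases : degIn (F st v s) σ ≡ 0 ⊎ ∃[ f ] f ∈ˡ F st v s × σ ⊆ f →
          ℕ→ℚ (degIn (P st′ s) σ) ≤ℚ θ s σ + ℕ→ℚ (r ∸ s) * Θ s ∣ σ ∣
        by-cases (inj₁ none) = subst (λ k → ℕ→ℚ k ≤ℚ _) (sym (degIn-untouched none)) (bounded old small)
        by-cases (inj₂ (f , f∈F , σ⊆f)) = begin
          ℕ→ℚ (degIn (P st′ s) σ)                                ≡⟨ cong ℕ→ℚ (degIn-updateLevel v st s σ) ⟩
          ℕ→ℚ (degIn (P st s) σ ℕ.+ degIn (F st v s) σ)          ≡⟨ ℕ→ℚ-+ (degIn (P st s) σ) _ ⟩
          ℕ→ℚ (degIn (P st s) σ) + ℕ→ℚ (degIn (F st v s) σ)      ≤⟨ ℚP.+-mono-≤ old≤θ F≤ ⟩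
          θ s σ + ℕ→ℚ (r ∸ s) * Θ s ∣ σ ∣                        ∎
          where
          open ℚP.≤-Reasoning
          avoid : T (avoids (Γ st s) f)
          avoid = proj₁ (F-member v st s f∈F)
          old≤θ : ℕ→ℚ (degIn (P st s) σ) ≤ℚ θ s σ
          old≤θ = Sum.[ (λ Γσ → contradiction Γσ (avoids⇒¬Γ avoid σ⊆f)) , (λ le → le) ] (saturated old small)
          v∉σ : v ∉ σ
          v∉σ = v∉above v ∘ proj₂ (proj₂ (F-member v st s f∈F)) ∘ σ⊆f
          F≤ : ℕ→ℚ (degIn (F st v s) σ) ≤ℚ ℕ→ℚ (r ∸ s) * Θ s ∣ σ ∣
          F≤ = ℚP.≤-trans (ℕ→ℚ-mono-≤ (degIn-F≤ v st s σ)) (codegree-bound inv lvl (∣p∪⁅x⁆∣≡1+∣p∣ σ v v∉σ) 1≤∣σ∣ ∣σ∣≤s)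

      updateLevel-invariant : Invariant st′
      updateLevel-invariant = record
        { top   = trans (P-updateLevel-≢ v st s (λ r≡s → ℕP.<-irrefl (sym r≡s) (proj₂ lvl))) (top inv)
        ; level = λ {t} lt → by-cases t lt (t ℕ.≟ s)
        }
        where
        by-cases : ∀ t → Level t → Dec (t ≡ s) → LevelInvariant st′ t
        by-cases t lt (yes refl) = record
          { uniform   = subst (All _) (sym (P-updateLevel v st s))
                          (++⁺ (uniform old) (All.tabulate (λ f∈F → proj₁ (proj₂ (F-member v st s f∈F)))))
          ; saturated = saturated-updateLevel
          ; bounded   = bounded-updateLevel
          }
        by-cases t lt (no t≢s) = LevelInvariant-cong (sym (P-updateLevel-≢ v st s t≢s)) (λ σ → sym (Γ-updateLevel-≢ v st s t≢s σ))
                                   (level inv lt)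

    fold-invariant : ∀ v ls {st} → All Level ls → Invariant st → Invariant (foldl (updateLevel v) st ls)
    fold-invariant v []       All.[]           inv = inv
    fold-invariant v (s ∷ ls) (lvl All.∷ lvls) inv = fold-invariant v ls lvls (updateLevel-invariant inv lvl)

  Γ₁ : AlgState G → Subset n
  Γ₁ st = tabulate (λ v → Γ st 1 ⁅ v ⁆)

  unsaturated : AlgState G → Subset n
  unsaturated st = Tₛ st ─ Γ₁ st

  weight : AlgState G → ℚ
  weight st = sumℚ (map (λ s → τ ^ℚ s * ℕ→ℚ (length (P st s))) levels)

  Potential : AlgState G → Set
  Potential st = τ ^ℚ (r ∸ 1) * ζ * ℕ→ℚ (sumOver (degV G) (unsaturated st) (allFin n)) ≤ℚ weight st

  fires : AlgState G → Fin n → Bool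
  fires st v = not (inB v) ∧ condition st v ∧ does (v ∈? I)

  fired : AlgState G → Fin n → AlgState G
  fired st v = foldl (updateLevel v) (record st { T = addToT v (Tₛ st) }) levels

  step-elim : ∀ (Q : AlgState G → Set) st v → Q st → (T (fires st v) → Q (fired st v)) → Q (step st v)
  step-elim Q st v Q-idle Q-fired = by-cases (fires st v) refl
    where
    by-cases : ∀ b → fires st v ≡ b → Q (step st v)
    by-cases false eq = subst Q (cong (λ b → if b then fired st v else st) (sym eq)) Q-idle
    by-cases true  eq = subst Q (cong (λ b → if b then fired st v else st) (sym eq)) (Q-fired (subst T (sym eq) _))

  ∈levels⇒Level : ∀ {s} → s ∈ˡ levels → Level s
  ∈levels⇒Level s∈ = let 1≤s , s≤r∸1 = ∈-applyUpTo-suc⁻ s∈ in 1≤s , 1≤m≤n∸1⇒m<n 1≤s s≤r∸1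

  module _ {st : AlgState G} {v : Fin n} where

    ∈addToT⁻ : ∀ {u U} → u ∈ addToT v U → u ∈ U ⊎ u ≡ v
    ∈addToT⁻ {u} {U} u∈ = by-cases (u ∈? U) (Fin.toℕ u ℕ.≟ Fin.toℕ v) (∈-tabulate⁻ _ u∈)
      where
      by-cases : (u∈U? : Dec (u ∈ U)) (u≟v : Dec (Fin.toℕ u ≡ Fin.toℕ v)) → T (does u∈U? ∨ does u≟v) → u ∈ U ⊎ u ≡ v
      by-cases (yes u∈U) _        _ = inj₁ u∈U
      by-cases (no _)    (yes eq) _ = inj₂ (FinP.toℕ-injective eq)

    Γ₁-fired-mono : ∀ {u} → T (Γ st 1 ⁅ u ⁆) → u ∈ Γ₁ (fired st v)
    Γ₁-fired-mono Γu = ∈-tabulate⁺ _ (fold-Γ-mono v levels 1 Γu)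

    unsaturated-fired : ∀ {u} → u ∈ unsaturated (fired st v) → u ∈ unsaturated st ⊎ u ≡ v
    unsaturated-fired {u} u∈ with u∈T , u∉Γ₁ ← ∈─⁻ (Tₛ (fired st v)) (Γ₁ (fired st v)) u∈ =
      Sum.map₁ (λ u∈Tₛ → ∈─⁺ (Tₛ st) (Γ₁ st) u∈Tₛ (u∉Γ₁ ∘ Γ₁-fired-mono ∘ ∈-tabulate⁻ _))
        (∈addToT⁻ (subst (u ∈_) (fold-Tₛ v levels _) u∈T))

    weight-fired-mono : 0ℚ ≤ℚ τ → ∀ s → τ ^ℚ s * ℕ→ℚ (length (P st s)) ≤ℚ τ ^ℚ s * ℕ→ℚ (length (P (fired st v) s))
    weight-fired-mono 0≤τ s = *-monoˡ-≤-0≤ (0≤^ℚ 0≤τ s) (ℕ→ℚ-mono-≤ (fold-length-mono v levels _ s))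

    weight-fired : 0ℚ ≤ℚ τ → ∀ {s} → s ∈ˡ levels → weight st + τ ^ℚ s * ℕ→ℚ (length (F st v s)) ≤ℚ weight (fired st v)
    weight-fired 0≤τ {s} s∈ = sumℚ-mono-+ _ _ (weight-fired-mono 0≤τ) s∈ (begin
      τ ^ℚ s * ℕ→ℚ (length (P st s)) + τ ^ℚ s * ℕ→ℚ (length (F st v s))
        ≡⟨ ℚP.*-distribˡ-+ (τ ^ℚ s) _ _ ⟨
      τ ^ℚ s * (ℕ→ℚ (length (P st s)) + ℕ→ℚ (length (F st v s)))
        ≡⟨ cong (τ ^ℚ s *_) (ℕ→ℚ-+ (length (P st s)) _) ⟨
      τ ^ℚ s * ℕ→ℚ (length (P st s) ℕ.+ length (F st v s))
        ≤⟨ *-monoˡ-≤-0≤ (0≤^ℚ 0≤τ s) (ℕ→ℚ-mono-≤ (fold-levels-growth v (r ∸ 1) _ 1≤s s≤r∸1)) ⟩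
      τ ^ℚ s * ℕ→ℚ (length (P (fired st v) s)) ∎)
      where
      open ℚP.≤-Reasoning
      1≤s : 1 ≤ s
      1≤s = proj₁ (∈-applyUpTo-suc⁻ s∈)
      s≤r∸1 : s ≤ r ∸ 1
      s≤r∸1 = proj₂ (∈-applyUpTo-suc⁻ s∈)

    fires-outside-Γ₁ : T (fires st v) → ¬ T (Γ st 1 ⁅ v ⁆) →
      ∃[ s ] s ∈ˡ levels × ζ * τ ^ℚ (r ∸ s ∸ 1) * ℕ→ℚ (degV G v) ≤ℚ ℕ→ℚ (length (F st v s))
    fires-outside-Γ₁ fire ¬Γv =
      let _ , cond∧I = Equivalence.to (T-∧ {not (inB v)}) fire
          cond , _   = Equivalence.to (T-∧ {condition st v}) cond∧I
          large      = Sum.[ (λ a → a) , (λ Γv → contradiction Γv ¬Γv) ]′ (Equivalence.to (T-∨ {any large-F? levels}) cond)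
          s , s∈ , F-large = find (any⁻ large-F? levels large)
      in s , s∈ , ℚP.≤ᵇ⇒≤ F-large
      where
      large-F? : ℕ → Bool
      large-F? s = (ζ * (τ ^ℚ (r ∸ s ∸ 1)) * ℕ→ℚ (degV G v)) ℚ.≤ᵇ ℕ→ℚ (length (F st v s))

    potential-fired : 0ℚ ≤ℚ τ → 0ℚ ≤ℚ ζ → Potential st → T (fires st v) → Potential (fired st v)
    potential-fired 0≤τ 0≤ζ pot fire = by-cases (v ∈? unsaturated (fired st v))
      where
      open ℚP.≤-Reasoning
      c : ℚ
      c = τ ^ℚ (r ∸ 1) * ζ
      0≤c : 0ℚ ≤ℚ c
      0≤c = 0≤* (0≤^ℚ 0≤τ (r ∸ 1)) 0≤ζ
      S S′ : ℕ
      S  = sumOver (degV G) (unsaturated st) (allFin n)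
      S′ = sumOver (degV G) (unsaturated (fired st v)) (allFin n)
      by-cases : Dec (v ∈ unsaturated (fired st v)) → Potential (fired st v)
      by-cases (no v∉) = begin
        c * ℕ→ℚ S′
          ≤⟨ *-monoˡ-≤-0≤ 0≤c (ℕ→ℚ-mono-≤ (sumOver-mono (degV G) (allFin n) (All.tabulate λ _ → still-unsaturated))) ⟩
        c * ℕ→ℚ S            ≤⟨ pot ⟩
        weight st            ≤⟨ sumℚ-mono _ _ levels (weight-fired-mono 0≤τ) ⟩
        weight (fired st v)  ∎
        where
        still-unsaturated : ∀ {u} → u ∈ unsaturated (fired st v) → u ∈ unsaturated st
        still-unsaturated u∈ = Sum.[ (λ u∈′ → u∈′) , (λ { refl → contradiction u∈ v∉ }) ]′ (unsaturated-fired u∈)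
      by-cases (yes v∈) = gain (fires-outside-Γ₁ fire (λ Γv → proj₂ (∈─⁻ _ _ v∈) (Γ₁-fired-mono Γv)))
        where
        gain : ∃[ s ] s ∈ˡ levels × ζ * τ ^ℚ (r ∸ s ∸ 1) * ℕ→ℚ (degV G v) ≤ℚ ℕ→ℚ (length (F st v s)) →
          Potential (fired st v)
        gain (s , s∈ , F-large) = begin
          c * ℕ→ℚ S′
            ≤⟨ *-monoˡ-≤-0≤ 0≤c (ℕ→ℚ-mono-≤ (sumOver-⊆∪⁅⁆ (degV G) (allFin n) (allFin⁺ n) unsaturated-fired)) ⟩
          c * ℕ→ℚ (S ℕ.+ degV G v)                          ≡⟨ cong (c *_) (ℕ→ℚ-+ S (degV G v)) ⟩
          c * (ℕ→ℚ S + ℕ→ℚ (degV G v))                      ≡⟨ ℚP.*-distribˡ-+ c (ℕ→ℚ S) _ ⟩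
          c * ℕ→ℚ S + c * ℕ→ℚ (degV G v)
            ≤⟨ ℚP.+-mono-≤ pot (ℚP.≤-trans (ℚP.≤-reflexive (^ℚ-split τ ζ (ℕ→ℚ (degV G v)) (proj₂ (∈levels⇒Level s∈))))
                                           (*-monoˡ-≤-0≤ (0≤^ℚ 0≤τ s) F-large)) ⟩
          weight st + τ ^ℚ s * ℕ→ℚ (length (F st v s))      ≤⟨ weight-fired 0≤τ s∈ ⟩
          weight (fired st v)                               ∎

  module Initial (0≤δ : 0ℚ ≤ℚ δ) (0≤d : 0ℚ ≤ℚ d) (0≤τ : 0ℚ ≤ℚ τ) where

    0≤Θ : ∀ s k → 0ℚ ≤ℚ Θ s k
    0≤Θ s k = 0≤* (0≤* 0≤δ 0≤d) (0≤^ℚ 0≤τ ((r ∸ s) ℕ.+ k ∸ 1))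

    0≤θ : ∀ s σ → 0ℚ ≤ℚ θ s σ
    0≤θ s σ with ∣ σ ∣
    ... | 0           = 0≤Θ s 0
    ... | 1           = 0≤* (0≤^ℚ 0≤τ (r ∸ s)) (0≤ℕ→ℚ (deg G σ))
    ... | suc (suc k) = 0≤Θ s (suc (suc k))

    P-initial : ∀ {s} → s ℕ.< r → P initial s ≡ []
    P-initial s<r = if-≡ᵇ-≢ (edges G) [] (ℕP.<⇒≢ s<r)

    initial-invariant : Invariant initial
    initial-invariant = record
      { top   = if-≡ᵇ-refl r (edges G) []
      ; level = λ {s} (_ , s<r) → record
        { uniform   = subst (All _) (sym (P-initial s<r)) All.[]
        ; saturated = λ {σ} _ → inj₂ (subst (λ Ps → ℕ→ℚ (degIn Ps σ) ≤ℚ θ s σ) (sym (P-initial s<r)) (0≤θ s σ))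
        ; bounded   = λ {σ} _ → subst (λ Ps → ℕ→ℚ (degIn Ps σ) ≤ℚ θ s σ + ℕ→ℚ (r ∸ s) * Θ s ∣ σ ∣) (sym (P-initial s<r))
                        (ℚP.+-mono-≤ (0≤θ s σ) (0≤* (0≤ℕ→ℚ (r ∸ s)) (0≤Θ s ∣ σ ∣)))
        }
      }

    initial-potential : Potential initial
    initial-potential = begin
      τ ^ℚ (r ∸ 1) * ζ * ℕ→ℚ (sumOver (degV G) (unsaturated initial) (allFin n))
        ≡⟨ cong (λ k → τ ^ℚ (r ∸ 1) * ζ * ℕ→ℚ k) (sumOver-empty (degV G) (allFin n) λ u → ∉⊥ ∘ proj₁ ∘ ∈─⁻ ⊥ (Γ₁ initial)) ⟩
      τ ^ℚ (r ∸ 1) * ζ * 0ℚ  ≡⟨ ℚP.*-zeroʳ (τ ^ℚ (r ∸ 1) * ζ) ⟩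
      0ℚ                      ≤⟨ sumℚ-0≤ _ levels (λ s → 0≤* (0≤^ℚ 0≤τ s) (0≤ℕ→ℚ (length (P initial s)))) ⟩
      weight initial          ∎
      where open ℚP.≤-Reasoning

  module Preservation (δ-bound : DeltaBound G τ δ) (0≤τ : 0ℚ ≤ℚ τ) (0≤ζ : 0ℚ ≤ℚ ζ) where

    step-preserves : ∀ {st} v → Invariant st × Potential st → Invariant (step st v) × Potential (step st v)
    step-preserves {st} v (inv , pot) = step-elim (λ st′ → Invariant st′ × Potential st′) st v (inv , pot) λ fire →
      fold-invariant δ-bound v levels (All.tabulate ∈levels⇒Level)
        (record { top = top inv ; level = λ lvl → LevelInvariant-cong refl (λ _ → refl) (level inv lvl) }) ,
      potential-fired 0≤τ 0≤ζ pot fire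

    run-preserves : ∀ vs {st} → Invariant st × Potential st → Invariant (foldl step st vs) × Potential (foldl step st vs)
    run-preserves []       inv×pot = inv×pot
    run-preserves (v ∷ vs) inv×pot = run-preserves vs (step-preserves v inv×pot)

  module Bound (0<d : 0ℚ < d) (0<τ : 0ℚ < τ) (0<ζ : 0ℚ < ζ) (isδ : IsDelta G τ δ) where

    D : ℚ
    D = ℕ→ℚ (totalDeg G)

    0<D : 0ℚ < D
    0<D = proj₁ (0<frac⇒0<args (totalDeg G) n 0<d)

    n*d≡D : ℕ→ℚ n * d ≡ D
    n*d≡D = trans (ℚP.*-comm (ℕ→ℚ n) d) (frac-*-cancelʳ (totalDeg G) n (proj₂ (0<frac⇒0<args (totalDeg G) n 0<d)))

    0≤δ : 0ℚ ≤ℚ δ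
    0≤δ = IsDelta⇒0≤δ G 0<d 0<τ isδ

    0≤τ : 0ℚ ≤ℚ τ
    0≤τ = ℚP.<⇒≤ 0<τ

    length-bound : ∀ {st s} → Invariant st → Level s →
      ℕ→ℚ (length (P st s)) ≤ℚ τ ^ℚ (r ∸ s) * D + ℕ→ℚ n * (ℕ→ℚ (r ∸ s) * Θ s 1)
    length-bound {st} {s} inv lvl@(1≤s , _) = begin
      ℕ→ℚ (length Ps)
        ≤⟨ ℕ→ℚ-mono-≤ (length≤Σdeg Ps (All.map (λ ∣f∣≡s → subst (1 ≤_) (sym ∣f∣≡s) 1≤s) (uniform li))) ⟩
      ℕ→ℚ (sum (map (λ u → degIn Ps ⁅ u ⁆) (allFin n)))
        ≡⟨ ℕ→ℚ-sum (λ u → degIn Ps ⁅ u ⁆) (allFin n) ⟩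
      sumℚ (map (λ u → ℕ→ℚ (degIn Ps ⁅ u ⁆)) (allFin n))
        ≤⟨ sumℚ-mono _ _ (allFin n) singleton-bound ⟩
      sumℚ (map (λ u → τ ^ℚ (r ∸ s) * ℕ→ℚ (degV G u) + ℕ→ℚ (r ∸ s) * Θ s 1) (allFin n))
        ≡⟨ sumℚ-affine (degV G) (τ ^ℚ (r ∸ s)) (ℕ→ℚ (r ∸ s) * Θ s 1) (allFin n) ⟩
      τ ^ℚ (r ∸ s) * D + ℕ→ℚ (length (allFin n)) * (ℕ→ℚ (r ∸ s) * Θ s 1)
        ≡⟨ cong (λ m → τ ^ℚ (r ∸ s) * D + ℕ→ℚ m * (ℕ→ℚ (r ∸ s) * Θ s 1)) (ListP.length-tabulate {n = n} id) ⟩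
      τ ^ℚ (r ∸ s) * D + ℕ→ℚ n * (ℕ→ℚ (r ∸ s) * Θ s 1) ∎
      where
      open ℚP.≤-Reasoning
      Ps : List (Subset n)
      Ps = P st s
      li : LevelInvariant st s
      li = level inv lvl
      singleton-bound : ∀ u → ℕ→ℚ (degIn Ps ⁅ u ⁆) ≤ℚ τ ^ℚ (r ∸ s) * ℕ→ℚ (degV G u) + ℕ→ℚ (r ∸ s) * Θ s 1
      singleton-bound u = subst₂ (λ a k → ℕ→ℚ (degIn Ps ⁅ u ⁆) ≤ℚ a + ℕ→ℚ (r ∸ s) * Θ s k) (θ⁅⁆ s u) (∣⁅x⁆∣≡1 u)
        (bounded li (ℕP.≤-reflexive (sym (∣⁅x⁆∣≡1 u)) , subst (_≤ s) (sym (∣⁅x⁆∣≡1 u)) 1≤s))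

    level-bound : ∀ {st s} → Invariant st → Level s → τ ^ℚ s * ℕ→ℚ (length (P st s)) ≤ℚ τ ^ℚ r * (D + ℕ→ℚ r * δ * D)
    level-bound {st} {s} inv lvl@(_ , s<r) = begin
      τ ^ℚ s * ℕ→ℚ (length (P st s))
        ≤⟨ *-monoˡ-≤-0≤ (0≤^ℚ 0≤τ s) (length-bound inv lvl) ⟩
      τ ^ℚ s * (τ ^ℚ (r ∸ s) * D + ℕ→ℚ n * (ℕ→ℚ (r ∸ s) * (δ * d * τ ^ℚ ((r ∸ s) ℕ.+ 1 ∸ 1))))
        ≡⟨ cong (λ e → τ ^ℚ s * (τ ^ℚ (r ∸ s) * D + ℕ→ℚ n * (ℕ→ℚ (r ∸ s) * (δ * d * τ ^ℚ e)))) (ℕP.m+n∸n≡m (r ∸ s) 1) ⟩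
      τ ^ℚ s * (τ ^ℚ (r ∸ s) * D + ℕ→ℚ n * (ℕ→ℚ (r ∸ s) * (δ * d * τ ^ℚ (r ∸ s))))
        ≡⟨ RS.solve 7 (λ a b D n k δ d → a RS.:* (b RS.:* D RS.:+ n RS.:* (k RS.:* (δ RS.:* d RS.:* b)))
                                         RS.:= (a RS.:* b) RS.:* (D RS.:+ k RS.:* δ RS.:* (n RS.:* d))) refl
             (τ ^ℚ s) (τ ^ℚ (r ∸ s)) D (ℕ→ℚ n) (ℕ→ℚ (r ∸ s)) δ d ⟩
      τ ^ℚ s * τ ^ℚ (r ∸ s) * (D + ℕ→ℚ (r ∸ s) * δ * (ℕ→ℚ n * d))
        ≡⟨ cong₂ (λ t e → t * (D + ℕ→ℚ (r ∸ s) * δ * e))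
             (trans (sym (^ℚ-+ τ s (r ∸ s))) (cong (τ ^ℚ_) (ℕP.m+[n∸m]≡n (ℕP.<⇒≤ s<r)))) n*d≡D ⟩
      τ ^ℚ r * (D + ℕ→ℚ (r ∸ s) * δ * D)
        ≤⟨ *-monoˡ-≤-0≤ (0≤^ℚ 0≤τ r) (ℚP.+-monoʳ-≤ D (*-monoʳ-≤-0≤ (ℚP.<⇒≤ 0<D)
             (*-monoʳ-≤-0≤ 0≤δ (ℕ→ℚ-mono-≤ (ℕP.m∸n≤m r s))))) ⟩
      τ ^ℚ r * (D + ℕ→ℚ r * δ * D) ∎
      where open ℚP.≤-Reasoning

    weight-bound : ∀ {st} → Invariant st → weight st ≤ℚ ℕ→ℚ (r ∸ 1) * (τ ^ℚ r * (D + ℕ→ℚ r * δ * D))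
    weight-bound {st} inv = subst (λ l → weight st ≤ℚ ℕ→ℚ l * (τ ^ℚ r * (D + ℕ→ℚ r * δ * D)))
      (ListP.length-applyUpTo suc (r ∸ 1))
      (sumℚ-≤-length-* _ levels _ (λ s∈ → level-bound inv (∈levels⇒Level s∈)))

    final-invariant×potential : Invariant final × Potential final
    final-invariant×potential = Preservation.run-preserves (IsDelta.bound isδ) 0≤τ (ℚP.<⇒≤ 0<ζ) (allFin n)
      (Initial.initial-invariant 0≤δ (ℚP.<⇒≤ 0<d) 0≤τ , Initial.initial-potential 0≤δ (ℚP.<⇒≤ 0<d) 0≤τ)

    μ-unsaturated-bound : 1 ≤ r →
      μ G (unsaturated final) ≤ℚ ℕ→ℚ (r ∸ 1) * _÷_ τ ζ {{>-nonZero 0<ζ}} * (1ℚ + ℕ→ℚ r * δ)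
    μ-unsaturated-bound 1≤r = *-cancelʳ-≤-0< 0<X (begin
      μ G (unsaturated final) * X                  ≡⟨ μ*X ⟩
      τ ^ℚ (r ∸ 1) * ζ * ℕ→ℚ S                     ≤⟨ proj₂ final-invariant×potential ⟩
      weight final                                 ≤⟨ weight-bound (proj₁ final-invariant×potential) ⟩
      ℕ→ℚ (r ∸ 1) * (τ ^ℚ r * (D + ℕ→ℚ r * δ * D)) ≡⟨ R*X ⟨
      R * X                                        ∎)
      where
      open ℚP.≤-Reasoning
      instance
        ζ≢0 : ℚ.NonZero ζ
        ζ≢0 = ℚ.>-nonZero 0<ζ
      S : ℕ
      S = sumOver (degV G) (unsaturated final) (allFin n)
      R X : ℚ
      R = ℕ→ℚ (r ∸ 1) * (τ ℚ.÷ ζ) * (1ℚ + ℕ→ℚ r * δ)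
      X = τ ^ℚ (r ∸ 1) * ζ * D
      0<X : 0ℚ < X
      0<X = 0<* (0<* (0<^ℚ 0<τ (r ∸ 1)) 0<ζ) 0<D
      μ*X : μ G (unsaturated final) * X ≡ τ ^ℚ (r ∸ 1) * ζ * ℕ→ℚ S
      μ*X = trans (RS.solve 4 (λ m a z t → m RS.:* (a RS.:* z RS.:* t) RS.:= a RS.:* z RS.:* (m RS.:* t)) refl
                     (μ G (unsaturated final)) (τ ^ℚ (r ∸ 1)) ζ D)
                  (cong (τ ^ℚ (r ∸ 1) * ζ *_) (frac-*-cancelʳ S (totalDeg G) 0<D))
      R*X : R * X ≡ ℕ→ℚ (r ∸ 1) * (τ ^ℚ r * (D + ℕ→ℚ r * δ * D))
      R*X = begin-equality
        ℕ→ℚ (r ∸ 1) * (τ * ℚ.1/ ζ) * (1ℚ + ℕ→ℚ r * δ) * (τ ^ℚ (r ∸ 1) * ζ * D)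
          ≡⟨ RS.solve 8 (λ k t z′ ρ δ a D z →
               k RS.:* (t RS.:* z′) RS.:* (RS.con 1ℚ RS.:+ ρ RS.:* δ) RS.:* (a RS.:* z RS.:* D)
               RS.:= k RS.:* ((t RS.:* a) RS.:* (D RS.:+ ρ RS.:* δ RS.:* D)) RS.:* (z′ RS.:* z)) refl
               (ℕ→ℚ (r ∸ 1)) τ (ℚ.1/ ζ) (ℕ→ℚ r) δ (τ ^ℚ (r ∸ 1)) D ζ ⟩
        ℕ→ℚ (r ∸ 1) * (τ * τ ^ℚ (r ∸ 1) * (D + ℕ→ℚ r * δ * D)) * (ℚ.1/ ζ * ζ)
          ≡⟨ cong (ℕ→ℚ (r ∸ 1) * (τ * τ ^ℚ (r ∸ 1) * (D + ℕ→ℚ r * δ * D)) *_) (ℚP.*-inverseˡ ζ) ⟩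
        ℕ→ℚ (r ∸ 1) * (τ * τ ^ℚ (r ∸ 1) * (D + ℕ→ℚ r * δ * D)) * 1ℚ
          ≡⟨ ℚP.*-identityʳ _ ⟩
        ℕ→ℚ (r ∸ 1) * (τ ^ℚ suc (r ∸ 1) * (D + ℕ→ℚ r * δ * D))
          ≡⟨ cong (λ k → ℕ→ℚ (r ∸ 1) * (τ ^ℚ k * (D + ℕ→ℚ r * δ * D))) (ℕP.suc-pred r {{ℕ.>-nonZero 1≤r}}) ⟩
        ℕ→ℚ (r ∸ 1) * (τ ^ℚ r * (D + ℕ→ℚ r * δ * D)) ∎

lemma3p6 : ∀ {r n : ℕ} → 2 ≤ r → (G : RGraph r n) → 0ℚ < avgDeg G →
    (τ ζ δ : ℚ) → (τ>0 : 0ℚ < τ) → (ζ>0 : 0ℚ < ζ) → IsDelta G τ δ →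
    (I : Subset n) →
    μ G (Run.outT G τ ζ δ I ─ Run.Γ₁vertices G τ ζ δ I)
      ≤ℚ (ℕ→ℚ (r ∸ 1) * _÷_ τ ζ {{>-nonZero ζ>0}} * (1ℚ + ℕ→ℚ r * δ))
lemma3p6 2≤r G 0<d τ ζ δ 0<τ 0<ζ isδ I =
  Analysis.Bound.μ-unsaturated-bound G τ ζ δ I 0<d 0<τ 0<ζ isδ (ℕP.≤-trans (s≤s z≤n) 2≤r)
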